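{- Let $G$ be a graph and $m \geq 1$ an integer. If there exists an optimal packing coloring of $FSSD_m(G)$ (i.e. a $\chi_\rho(FSSD_m(G))$-packing coloring) which assigns color $1$ to all subdivided vertices, then $\chi_\rho(FSSD_m(G)) = \chi_\rho(FSSD_{m+1}(G))$.
   Context: All graphs are finite and simple. For a positive integer $i$, an $i$-packing is a set of vertices in which any two distinct vertices are at distance greater than $i$. A $k$-packing coloring of a graph $H$ is a map $c:V(H)\to\{1,\dots,k\}$ such that $c(u)=c(v)=i$ for distinct $u,v$ implies $d_H(u,v)>i$; the packing chromatic number $\chi_\rho(H)$ is the smallest $k$ for which a $k$-packing coloring exists, and a $\chi_\rho(H)$-packing coloring is called optimal. For a positive integer $m$, the finite super subdivision graph $FSSD_m(G)$ is obtained from $G$ by replacing each edge $uv$ of $G$ by a complete bipartite graph $K_{2,m}$ whose part of size $2$ is $\{u,v\}$; that is, the edge $uv$ is deleted and $m$ new vertices, called subdivided vertices, are added, each adjacent exactly to $u$ and $v$. The vertices of $FSSD_m(G)$ that correspond to vertices of $G$ are not subdivided vertices. -}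

module Defs where

open import Data.Nat using (ℕ; zero; suc; _≤_)
open import Data.Fin using (Fin) renaming (_<_ to _<ᶠ_)
open import Data.Bool using (Bool; true; false; T)
open import Data.Product using (Σ; _×_; _,_)
open import Relation.Binary.PropositionalEquality using (_≡_; _≢_)
open import Relation.Nullary using (¬_)
open import Data.Empty using (⊥)
open import Data.Unit using (⊤)

data Walk {V : Set} (Adj : V → V → Set) : V → V → ℕ → Set where
  nil  : ∀ {u} → Walk Adj u u 0
  cons : ∀ {u w v k} → Adj u w → Walk Adj w v k → Walk Adj u v (suc k)

-- d(u,v) ≤ i  iff  there is a walk of length at most i from u to v.
-- (d(u,v) > i is its negation; disconnected vertices have d = ∞.)
DistLe : {V : Set} (Adj : V → V → Set) → V → V → ℕ → Set
DistLe Adj u v i = Σ ℕ λ j → j ≤ i × Walk Adj u v j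

IsPackingColoring : {V : Set} (Adj : V → V → Set) → ℕ → (V → ℕ) → Set
IsPackingColoring {V} Adj k c =
  (∀ v → 1 ≤ c v × c v ≤ k) ×
  (∀ (u v : V) (i : ℕ) → u ≢ v → c u ≡ i → c v ≡ i → ¬ DistLe Adj u v i)

IsPackingChromaticNumber : {V : Set} (Adj : V → V → Set) → ℕ → Set
IsPackingChromaticNumber {V} Adj k =
  (Σ (V → ℕ) λ c → IsPackingColoring Adj k c) ×
  (∀ (j : ℕ) (c : V → ℕ) → IsPackingColoring Adj j c → k ≤ j)

record SimpleGraph (n : ℕ) : Set where
  field
    adj    : Fin n → Fin n → Bool
    sym    : ∀ u v → adj u v ≡ adj v u
    irrefl : ∀ u → adj u u ≡ false
open SimpleGraph public

-- Finite super subdivision FSSD_m(G).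
-- Vertices: original vertices of G, and for every edge {u,v} of G
-- (represented once, with u < v) m subdivided vertices (indexed by Fin m).

data FSSDVertex {n : ℕ} (G : SimpleGraph n) (m : ℕ) : Set where
  orig : Fin n → FSSDVertex G m
  sub  : (u v : Fin n) → u <ᶠ v → T (adj G u v) → Fin m → FSSDVertex G m

data FSSDAdj {n : ℕ} (G : SimpleGraph n) (m : ℕ) :
             FSSDVertex G m → FSSDVertex G m → Set where
  o-sub₁ : ∀ {u v p q i} → FSSDAdj G m (orig u) (sub u v p q i)
  o-sub₂ : ∀ {u v p q i} → FSSDAdj G m (orig v) (sub u v p q i)
  sub-o₁ : ∀ {u v p q i} → FSSDAdj G m (sub u v p q i) (orig u)
  sub-o₂ : ∀ {u v p q i} → FSSDAdj G m (sub u v p q i) (orig v)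

IsSubdivided : {n : ℕ} {G : SimpleGraph n} {m : ℕ} → FSSDVertex G m → Set
IsSubdivided (orig _)        = ⊥
IsSubdivided (sub _ _ _ _ _) = ⊤

module Submission where

-- Let c be an optimal k-colouring of FSSD_m(G) giving colour 1 to
-- every subdivided vertex.
--   * Upper bound: the collapse FSSD_{m+1}(G) → FSSD_m(G), which sends every
--     subdivided vertex of an edge to the first subdivided vertex of that edge,
--     is a graph homomorphism whose nontrivial fibres consist of subdivided
--     vertices only.  Since c colours those with 1 and distinct subdivided
--     vertices are never adjacent, c ∘ collapse is a k-packing colouring.
--   * Lower bound: FSSD_m(G) embeds into FSSD_{m+1}(G) as a subgraph, so every
--     packing colouring of the larger graph restricts to the smaller one.
-- Both bounds are instances of one general fact (pullbackColouring): pulling a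
-- packing colouring back along a graph homomorphism yields a packing colouring,
-- provided every fibre with two or more vertices is an independent set on which
-- the colouring is 1.  The file first develops walks and this pullback lemma
-- for arbitrary graphs, then the two maps between super subdivisions, and
-- finally derives proposition4.

open import Defs hiding (sym)
open import Data.Nat using (ℕ; suc; _≤_; s≤s)
open import Data.Nat.Properties using (n≤1+n)
open import Data.Fin using (Fin; zero; inject≤) renaming (_<_ to _<ᶠ_)
open import Data.Bool using (T)
open import Data.Fin.Properties using (inject≤-injective)
open import Data.Product using (Σ; _×_; _,_)
open import Data.Empty using (⊥-elim)
open import Data.Unit using (tt)
open import Function using (_∘_)
open import Relation.Binary.PropositionalEquality
  using (_≡_; _≢_; refl; sym; trans; subst)
open import Relation.Nullary using (¬_)

mapWalk : {V W : Set} {A : V → V → Set} {B : W → W → Set} (h : V → W) →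
  (∀ {x y} → A x y → B (h x) (h y)) →
  ∀ {x y k} → Walk A x y k → Walk B (h x) (h y) k
mapWalk h hom nil        = nil
mapWalk h hom (cons a w) = cons (hom a) (mapWalk h hom w)

mapDistLe : {V W : Set} {A : V → V → Set} {B : W → W → Set} (h : V → W) →
  (∀ {x y} → A x y → B (h x) (h y)) →
  ∀ {x y i} → DistLe A x y i → DistLe B (h x) (h y) i
mapDistLe h hom (j , j≤i , w) = j , j≤i , mapWalk h hom w

walk-zero : {V : Set} {A : V → V → Set} {x y : V} → Walk A x y 0 → x ≡ y
walk-zero nil = refl

-- No
-- decidability of equality is needed: the case "h u ≡ h v" is exactly the
-- argument c expects for the hypothesis "h u ≢ h v".
pullbackColouring : {V W : Set} {A : V → V → Set} {B : W → W → Set}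
  (h : V → W) → (∀ {x y} → A x y → B (h x) (h y)) →
  {k : ℕ} {c : W → ℕ} → IsPackingColoring B k c →
  (∀ u v → u ≢ v → h u ≡ h v → c (h u) ≡ 1 × ¬ DistLe A u v 1) →
  IsPackingColoring A k (c ∘ h)
pullbackColouring h hom {c = c} (range , packing) fibres =
  (range ∘ h) , packing′
  where
  packing′ : ∀ u v i → u ≢ v → c (h u) ≡ i → c (h v) ≡ i → ¬ DistLe _ u v i
  packing′ u v i u≢v cu cv d = packing (h u) (h v) i identified cu cv (mapDistLe h hom d)
    where
    identified : h u ≢ h v
    identified e with fibres u v u≢v e
    ... | colour1 , far = far (subst (DistLe _ u v) (trans (sym cu) colour1) d)

pullbackInjective : {V W : Set} {A : V → V → Set} {B : W → W → Set}
  (h : V → W) → (∀ {x y} → A x y → B (h x) (h y)) →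
  (∀ {x y} → h x ≡ h y → x ≡ y) →
  {k : ℕ} {c : W → ℕ} → IsPackingColoring B k c → IsPackingColoring A k (c ∘ h)
pullbackInjective h hom inj colouring =
  pullbackColouring h hom colouring (λ u v u≢v e → ⊥-elim (u≢v (inj e)))

module _ {n : ℕ} (G : SimpleGraph n) where

  subdivided-far : ∀ {m} (x y : FSSDVertex G m) → IsSubdivided x → IsSubdivided y →
    x ≢ y → ¬ DistLe (FSSDAdj G m) x y 1
  subdivided-far x y _ _ x≢y (0 , _ , w) = x≢y (walk-zero w)
  subdivided-far _ (orig _) _ () _ (1 , _ , cons _ _)
  subdivided-far _ (sub _ _ _ _ _) _ _ _ (1 , _ , cons sub-o₁ w) with walk-zero w
  ... | ()
  subdivided-far _ (sub _ _ _ _ _) _ _ _ (1 , _ , cons sub-o₂ w) with walk-zero w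
  ... | ()
  subdivided-far _ _ _ _ _ (suc (suc _) , s≤s () , _)

  -- This transfers injectivity of an index map to the vertex map.
  sub-reindex : ∀ {m m′} {u u′ v v′ : Fin n} {p : u <ᶠ v} {p′ : u′ <ᶠ v′}
    {q : T (adj G u v)} {q′ : T (adj G u′ v′)} {a b : Fin m′} {i j : Fin m} →
    sub {G = G} u v p q a ≡ sub u′ v′ p′ q′ b → (a ≡ b → i ≡ j) →
    sub {G = G} u v p q i ≡ sub u′ v′ p′ q′ j
  sub-reindex refl indices with indices refl
  ... | refl = refl

  embed : ∀ {m m′} → m ≤ m′ → FSSDVertex G m → FSSDVertex G m′
  embed m≤m′ (orig a)        = orig a
  embed m≤m′ (sub u v p q i) = sub u v p q (inject≤ i m≤m′)

  embed-hom : ∀ {m m′} (m≤m′ : m ≤ m′) {x y} →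
    FSSDAdj G m x y → FSSDAdj G m′ (embed m≤m′ x) (embed m≤m′ y)
  embed-hom _ o-sub₁ = o-sub₁
  embed-hom _ o-sub₂ = o-sub₂
  embed-hom _ sub-o₁ = sub-o₁
  embed-hom _ sub-o₂ = sub-o₂

  embed-injective : ∀ {m m′} (m≤m′ : m ≤ m′) {x y : FSSDVertex G m} →
    embed m≤m′ x ≡ embed m≤m′ y → x ≡ y
  embed-injective m≤m′ {orig a} {orig .a} refl = refl
  embed-injective m≤m′ {sub _ _ _ _ i} {sub _ _ _ _ j} e =
    sub-reindex e (inject≤-injective m≤m′ m≤m′ i j)
  embed-injective m≤m′ {orig _} {sub _ _ _ _ _} ()
  embed-injective m≤m′ {sub _ _ _ _ _} {orig _} ()

  collapse : ∀ {m m′} → FSSDVertex G m′ → FSSDVertex G (suc m)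
  collapse (orig a)        = orig a
  collapse (sub u v p q _) = sub u v p q zero

  collapse-hom : ∀ {m m′ x y} →
    FSSDAdj G m′ x y → FSSDAdj G (suc m) (collapse x) (collapse y)
  collapse-hom o-sub₁ = o-sub₁
  collapse-hom o-sub₂ = o-sub₂
  collapse-hom sub-o₁ = sub-o₁
  collapse-hom sub-o₂ = sub-o₂

  collapse-fibre : ∀ {m m′} (x y : FSSDVertex G m′) → x ≢ y →
    collapse {m} x ≡ collapse y →
    IsSubdivided (collapse {m} x) × IsSubdivided x × IsSubdivided y
  collapse-fibre (orig a) (orig .a) x≢y refl = ⊥-elim (x≢y refl)
  collapse-fibre (sub _ _ _ _ _) (sub _ _ _ _ _) _ _ = tt , tt , tt
  collapse-fibre (orig _) (sub _ _ _ _ _) _ ()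
  collapse-fibre (sub _ _ _ _ _) (orig _) _ ()

proposition4 : (n : ℕ) (G : SimpleGraph n) (m : ℕ) → 1 ≤ m → (k : ℕ) →
    IsPackingChromaticNumber (FSSDAdj G m) k →
    (Σ (FSSDVertex G m → ℕ) λ c → IsPackingColoring (FSSDAdj G m) k c ×
       (∀ x → IsSubdivided x → c x ≡ 1)) →
    IsPackingChromaticNumber (FSSDAdj G (suc m)) k
proposition4 n G (suc m) _ k (_ , minimal) (c , colouring , subdivided↦1) =
  (c ∘ collapse G , pullbackColouring (collapse G) (collapse-hom G) colouring fibres) ,
  λ j d d-colouring →
    minimal j (d ∘ embed G (n≤1+n _))
      (pullbackInjective (embed G (n≤1+n _)) (embed-hom G _) (embed-injective G _) d-colouring)
  where
  fibres : ∀ u v → u ≢ v → collapse G u ≡ collapse G v →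
    c (collapse G u) ≡ 1 × ¬ DistLe (FSSDAdj G (suc (suc m))) u v 1
  fibres u v u≢v e with collapse-fibre G u v u≢v e
  ... | image-sub , u-sub , v-sub =
    subdivided↦1 _ image-sub , subdivided-far G u v u-sub v-sub u≢v
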